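{- There exists a spined category $(\mathcal{C},\Omega,\mathfrak{P})$ with $|\Omega_n|=n=\omega(\Omega_n)$ for all $n\in\mathbb{N}$ that admits no S-functor.
   Context: A spined category is a triple $(\mathcal{C},\Omega,\mathfrak{P})$: a category $\mathcal{C}$, a sequence of objects $(\Omega_n)_{n\in\mathbb{N}}$, and an operation $\mathfrak{P}$ assigning to each span $G\xleftarrow{g}\Omega_n\xrightarrow{h}H$ an object $\mathfrak{P}(g,h)$ and morphisms $\mathfrak{P}(g,h)_g:G\to\mathfrak{P}(g,h)$, $\mathfrak{P}(g,h)_h:H\to\mathfrak{P}(g,h)$ with $\mathfrak{P}(g,h)_gg=\mathfrak{P}(g,h)_hh$, such that (SC1) every object has a morphism to some $\Omega_n$; (SC2) for every such span and all $g':G\to G'$, $h':H\to H'$ there is a unique morphism $(g',h'):\mathfrak{P}(g,h)\to\mathfrak{P}(g'g,h'h)$ with $(g',h')\mathfrak{P}(g,h)_g=\mathfrak{P}(g'g,h'h)_{g'g}g'$ and $(g',h')\mathfrak{P}(g,h)_h=\mathfrak{P}(g'g,h'h)_{h'h}h'$. The order $|X|$ of an object $X$ is the least $n$ such that there is a morphism $X\to\Omega_n$; the generalized clique number $\omega(X)$ is the largest $n$ such that there is a morphism $\Omega_n\to X$. An S-functor is a functor $F$ from $\mathcal{C}$ to the poset $(\mathbb{N},\le)$ with $F(\Omega_n)=n$ for all $n$ and $F(\mathfrak{P}(g,h))=\max\{F(G),F(H)\}$ for every span $G\xleftarrow{g}\Omega_n\xrightarrow{h}H$. -}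

module Defs where

open import Level using (0ℓ)
open import Data.Nat using (ℕ; _≤_; _⊔_)
open import Data.Product using (Σ; ∃; _×_; _,_)
open import Relation.Binary.PropositionalEquality using (_≡_)

record Category : Set₁ where
  infixr 9 _∘_
  field
    Obj   : Set
    Hom   : Obj → Obj → Set
    id    : ∀ {X} → Hom X X
    _∘_   : ∀ {X Y Z} → Hom Y Z → Hom X Y → Hom X Z
    identityˡ : ∀ {X Y} (f : Hom X Y) → id ∘ f ≡ f
    identityʳ : ∀ {X Y} (f : Hom X Y) → f ∘ id ≡ f
    assoc : ∀ {W X Y Z} (h : Hom Y Z) (g : Hom X Y) (f : Hom W X) →
            (h ∘ g) ∘ f ≡ h ∘ (g ∘ f)

record SpinedCategory : Set₁ where
  field
    cat : Category
  open Category cat public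
  field
    Ω  : ℕ → Obj
    𝔓  : ∀ {n G H} → Hom (Ω n) G → Hom (Ω n) H → Obj
    𝔓ₗ : ∀ {n G H} (g : Hom (Ω n) G) (h : Hom (Ω n) H) → Hom G (𝔓 g h)
    𝔓ᵣ : ∀ {n G H} (g : Hom (Ω n) G) (h : Hom (Ω n) H) → Hom H (𝔓 g h)
    𝔓-comm : ∀ {n G H} (g : Hom (Ω n) G) (h : Hom (Ω n) H) →
             𝔓ₗ g h ∘ g ≡ 𝔓ᵣ g h ∘ h
    SC1 : ∀ (X : Obj) → ∃ λ n → Hom X (Ω n)
    SC2 : ∀ {n G H G′ H′} (g : Hom (Ω n) G) (h : Hom (Ω n) H)
            (g′ : Hom G G′) (h′ : Hom H H′) →
            Hom (𝔓 g h) (𝔓 (g′ ∘ g) (h′ ∘ h))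
    SC2-ₗ : ∀ {n G H G′ H′} (g : Hom (Ω n) G) (h : Hom (Ω n) H)
              (g′ : Hom G G′) (h′ : Hom H H′) →
              SC2 g h g′ h′ ∘ 𝔓ₗ g h ≡ 𝔓ₗ (g′ ∘ g) (h′ ∘ h) ∘ g′
    SC2-ᵣ : ∀ {n G H G′ H′} (g : Hom (Ω n) G) (h : Hom (Ω n) H)
              (g′ : Hom G G′) (h′ : Hom H H′) →
              SC2 g h g′ h′ ∘ 𝔓ᵣ g h ≡ 𝔓ᵣ (g′ ∘ g) (h′ ∘ h) ∘ h′
    SC2-unique : ∀ {n G H G′ H′} (g : Hom (Ω n) G) (h : Hom (Ω n) H)
                   (g′ : Hom G G′) (h′ : Hom H H′)
                   (m : Hom (𝔓 g h) (𝔓 (g′ ∘ g) (h′ ∘ h))) →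
                   m ∘ 𝔓ₗ g h ≡ 𝔓ₗ (g′ ∘ g) (h′ ∘ h) ∘ g′ →
                   m ∘ 𝔓ᵣ g h ≡ 𝔓ᵣ (g′ ∘ g) (h′ ∘ h) ∘ h′ →
                   m ≡ SC2 g h g′ h′

module _ (S : SpinedCategory) where
  open SpinedCategory S

  -- |X| = n : n is the least k with a morphism X → Ω k
  OrderIs : Obj → ℕ → Set
  OrderIs X n = Hom X (Ω n) × (∀ k → Hom X (Ω k) → n ≤ k)

  -- ω(X) = n : n is the largest k with a morphism Ω k → X
  CliqueNumberIs : Obj → ℕ → Set
  CliqueNumberIs X n = Hom (Ω n) X × (∀ k → Hom (Ω k) X → k ≤ n)

  -- An S-functor: a functor C → (ℕ, ≤) (functor laws are automatic,
  -- the target being a thin category) with F(Ω n) = n and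
  -- F(𝔓(g,h)) = max (F G) (F H).
  record SFunctor : Set where
    field
      F₀ : Obj → ℕ
      F₁ : ∀ {X Y} → Hom X Y → F₀ X ≤ F₀ Y
      F-Ω : ∀ n → F₀ (Ω n) ≡ n
      F-𝔓 : ∀ {n G H} (g : Hom (Ω n) G) (h : Hom (Ω n) H) →
            F₀ (𝔓 g h) ≡ F₀ G ⊔ F₀ H

module Submission where

-- Take the poset (ℕ, ≤) as a category with Ω n = n, so that |n| = n = ω(n),
-- but choose the gluing 𝔓(g, h) = 1 + max G H instead of the join max G H.
-- Since the category is thin, every diagram commutes and (SC2) only asks for
-- monotonicity of 𝔓 in G and H. For an S-functor F, gluing Ω 0 to itself
-- along Ω 0 gives 1 = F(Ω 1) = F(𝔓) = max (F(Ω 0)) (F(Ω 0)) = 0.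

open import Defs
open import Data.Product using (Σ; _×_; _,_)
open import Relation.Nullary using (¬_)
open import Data.Nat using (ℕ; suc; _≤_; _⊔_; z≤n; s≤s)
open import Data.Nat.Properties
  using (≤-irrelevant; ≤-refl; ≤-trans; m≤n⇒m≤1+n; m≤m⊔n; m≤n⊔m; ⊔-mono-≤; ⊔-idem; 1+n≢0)
open import Relation.Binary.PropositionalEquality using (_≡_; sym; module ≡-Reasoning)

≤-category : Category
≤-category = record
  { Obj       = ℕ
  ; Hom       = _≤_
  ; id        = ≤-refl
  ; _∘_       = λ f g → ≤-trans g f
  ; identityˡ = λ _ → ≤-irrelevant _ _
  ; identityʳ = λ _ → ≤-irrelevant _ _
  ; assoc     = λ _ _ _ → ≤-irrelevant _ _
  }

successor-gluing : SpinedCategory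
successor-gluing = record
  { cat        = ≤-category
  ; Ω          = λ n → n
  ; 𝔓          = λ {_} {G} {H} _ _ → suc (G ⊔ H)
  ; 𝔓ₗ         = λ {_} {G} {H} _ _ → m≤n⇒m≤1+n (m≤m⊔n G H)
  ; 𝔓ᵣ         = λ {_} {G} {H} _ _ → m≤n⇒m≤1+n (m≤n⊔m G H)
  ; 𝔓-comm     = λ _ _ → ≤-irrelevant _ _
  ; SC1        = λ X → X , ≤-refl
  ; SC2        = λ _ _ g′ h′ → s≤s (⊔-mono-≤ g′ h′)
  ; SC2-ₗ      = λ _ _ _ _ → ≤-irrelevant _ _
  ; SC2-ᵣ      = λ _ _ _ _ → ≤-irrelevant _ _
  ; SC2-unique = λ _ _ _ _ _ _ _ → ≤-irrelevant _ _
  }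

open SpinedCategory successor-gluing using (Ω)

Ω-order : ∀ n → OrderIs successor-gluing (Ω n) n
Ω-order n = ≤-refl , λ _ n≤k → n≤k

Ω-cliqueNumber : ∀ n → CliqueNumberIs successor-gluing (Ω n) n
Ω-cliqueNumber n = ≤-refl , λ _ k≤n → k≤n

no-SFunctor : ¬ SFunctor successor-gluing
no-SFunctor F = 1+n≢0 one≡zero
  where
  open SFunctor F
  open ≡-Reasoning
  one≡zero : 1 ≡ 0
  one≡zero = begin
    1                     ≡⟨ sym (F-Ω 1) ⟩
    F₀ 1                  ≡⟨ F-𝔓 {0} z≤n z≤n ⟩
    F₀ 0 ⊔ F₀ 0           ≡⟨ ⊔-idem (F₀ 0) ⟩
    F₀ 0                  ≡⟨ F-Ω 0 ⟩
    0                     ∎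

proposition3p9 : Σ SpinedCategory λ S → (∀ n → OrderIs S (SpinedCategory.Ω S n) n × CliqueNumberIs S (SpinedCategory.Ω S n) n) × ¬ SFunctor S
proposition3p9 = successor-gluing , (λ n → Ω-order n , Ω-cliqueNumber n) , no-SFunctor
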